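{- A triple $(X,\sigma,\nu)$, with $X\in\mathcal B$, $\sigma:\delta(X)\hat\otimes X\to X$ and $\nu:J\to\delta(X)$, is a linear substitution algebra if and only if it satisfies (a) $\sigma\circ(\nu\hat\otimes\mathrm{id}_X)=\lambda_X$, (b) $\delta(\sigma)\circ\mathsf{str}'_{\delta X,X}\circ(\mathrm{id}_{\delta X}\hat\otimes\nu)=r_{\delta X}$, and the extended substitution lemma $$\sigma\circ(\delta(\sigma)\hat\otimes\mathrm{id}_X)=\sigma^\dagger\circ\Sigma^\dagger_{\mathsf{sub}}(\mathrm{id}_X,\sigma)\circ\mathbf{str}^{\mathsf{sub}}_{X,\delta X,X}\circ(\mathbf{swap}^{\mathsf{sub}}_X\hat\otimes\mathrm{id}_X):\delta(\delta X\hat\otimes X)\hat\otimes X\to X.$$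
   Context: Let $\mathbb{B}$ be the category whose objects are the sets $\mathbf{n}=\{1,\dots,n\}$ ($n\in\mathbb{N}$) and whose morphisms are bijections; symmetric strict monoidal with $\mathbf n\otimes\mathbf m=\mathbf{n+m}$ (elements of $\mathbf m$ after those of $\mathbf n$, morphisms blockwise), unit $\mathbf 0$; $s:\mathbf 2\to\mathbf 2$ the transposition. $\mathcal B=\mathbf{Set}^{\mathbb B}$. Day convolution $(X\hat\otimes Y)(\mathbf n)=\int^{\mathbf m_1,\mathbf m_2}X(\mathbf m_1)\times Y(\mathbf m_2)\times\mathbb B(\mathbf{m_1+m_2},\mathbf n)$, classes $[x,y,f]$, unit $J=\mathbb B(\mathbf 0,-)$; symmetric monoidal closed (distributes over coproducts); associators suppressed, unitors $\lambda_X:J\hat\otimes X\to X$, $r_X:X\hat\otimes J\to X$, symmetry $\gamma$. $\delta:\mathcal B\to\mathcal B$, $\delta(X)(\mathbf n)=X(\mathbf{n+1})$, $\delta(X)(f)=X(f\otimes\mathrm{id}_{\mathbf 1})$. $\mathsf{swap}_X:\delta^2X\to\delta^2X$ has components $X(\mathrm{id}_{\mathbf n}\otimes s)$. Left strength $\mathsf{str}'_{X,Y}:X\hat\otimes\delta Y\to\delta(X\hat\otimes Y)$, $[x,y,f]\mapsto[x,y,f\otimes\mathrm{id}_{\mathbf 1}]$; right strength $\mathsf{str}_{X,Y}:\delta X\hat\otimes Y\to\delta(X\hat\otimes Y)$, $[x,y,f]\mapsto[x,y,(f\otimes\mathrm{id}_{\mathbf 1})\circ\theta]$ ($x\in X(\mathbf{m_1+1})$,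 $y\in Y(\mathbf m_2)$), where $\theta:\mathbf{m_1+1+m_2}\to\mathbf{m_1+m_2+1}$ fixes $1..m_1$, $m_1+1\mapsto m_1+m_2+1$, $m_1+1+i\mapsto m_1+i$. The morphism $[\mathsf{str}_{X,Y},\mathsf{str}'_{X,Y}]:\delta X\hat\otimes Y+X\hat\otimes\delta Y\to\delta(X\hat\otimes Y)$ is an isomorphism; $\mathcal L_{X,Y}$ is its inverse. A linear substitution algebra is $(X,\sigma,\nu)$ satisfying (a), (b) above and (c) $\sigma\circ(\mathrm{id}_{\delta X}\hat\otimes\sigma)=\sigma\circ(\delta\sigma\hat\otimes\mathrm{id}_X)\circ(\mathsf{str}'_{\delta X,X}\hat\otimes\mathrm{id}_X)$ on $\delta X\hat\otimes\delta X\hat\otimes X$; (d) $\sigma\circ(\delta\sigma\hat\otimes\mathrm{id})\circ(\mathsf{str}_{\delta X,X}\hat\otimes\mathrm{id})=\sigma\circ(\delta\sigma\hat\otimes\mathrm{id})\circ(\mathsf{str}_{\delta X,X}\hat\otimes\mathrm{id})\circ(\mathrm{id}_{\delta^2X}\hat\otimes\gamma_{X,X})\circ(\mathsf{swap}_X\hat\otimes\mathrm{id}_{X\hat\otimes X})$ on $\delta^2X\hat\otimes X\hat\otimes X$. Derived substitution functor: $\Sigma^\dagger_{\mathsf{sub}}(X,Y)=\delta(Y)\hat\otimes X+\delta(X)\hat\otimes Y$ (functorial in both arguments). $\mathbf{swap}^{\mathsf{sub}}_X=(\mathsf{swap}_X\hat\otimes\mathrm{id}_X+\mathrm{id})\circ\mathcal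 L_{\delta X,X}:\delta(\delta X\hat\otimes X)\to\delta^2X\hat\otimes X+\delta X\hat\otimes\delta X=\Sigma^\dagger_{\mathsf{sub}}(X,\delta X)$. $\mathbf{str}^{\mathsf{sub}}_{X,Y,Z}:\Sigma^\dagger_{\mathsf{sub}}(X,Y)\hat\otimes Z\to\Sigma^\dagger_{\mathsf{sub}}(X,Y\hat\otimes Z)$ is (after distributivity) $(\mathsf{str}_{Y,Z}\hat\otimes\mathrm{id}_X)\circ(\mathrm{id}_{\delta Y}\hat\otimes\gamma_{X,Z})$ on the first summand and the identity $\delta X\hat\otimes Y\hat\otimes Z\to\delta X\hat\otimes(Y\hat\otimes Z)$ on the second. $\sigma^\dagger=[\sigma,\sigma]:\Sigma^\dagger_{\mathsf{sub}}(X,X)=\delta X\hat\otimes X+\delta X\hat\otimes X\to X$. -}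

module Defs where

open import Level using (0ℓ)
open import Data.Nat using (ℕ; zero; suc; _+_)
open import Data.Fin using (Fin)
open import Data.Fin.Properties using (+↔⊎)
open import Data.Sum using (_⊎_; inj₁; inj₂; [_,_]′)
open import Data.Sum.Algebra using (⊎-cong; ⊎-comm; ⊎-assoc)
open import Data.Product using (Σ; _×_; _,_)
open import Function.Bundles using (_↔_; Inverse; _⇔_; mk↔ₛ′)
open import Function.Properties.Inverse using (↔-refl; ↔-sym; ↔-trans)
open import Relation.Binary.PropositionalEquality using (_≡_; refl)

-- The category 𝔹: objects are natural numbers n (standing for 𝐧 = Fin n),
-- morphisms 𝐦 → 𝐧 are bijections Fin m ↔ Fin n.

Bij : ℕ → ℕ → Set
Bij m n = Fin m ↔ Fin n

idB : ∀ {n} → Bij n n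
idB = ↔-refl

infixr 9 _∘B_
_∘B_ : ∀ {a b c} → Bij b c → Bij a b → Bij a c
g ∘B f = ↔-trans f g

invB : ∀ {a b} → Bij a b → Bij b a
invB = ↔-sym

infixr 9 _∘↔_
_∘↔_ : ∀ {A B C : Set} → B ↔ C → A ↔ B → A ↔ C
g ∘↔ f = ↔-trans f g

_≗B_ : ∀ {a b} → Bij a b → Bij a b → Set
f ≗B g = ∀ i → Inverse.to f i ≡ Inverse.to g i

infixr 7 _⊕_
_⊕_ : ∀ {a b c d} → Bij a c → Bij b d → Bij (a + b) (c + d)
f ⊕ g = ↔-sym +↔⊎ ∘↔ ⊎-cong f g ∘↔ +↔⊎

assocB : ∀ a b c → Bij ((a + b) + c) (a + (b + c))
assocB a b c = ↔-sym +↔⊎ ∘↔ ⊎-cong ↔-refl (↔-sym +↔⊎)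
             ∘↔ ⊎-assoc 0ℓ (Fin a) (Fin b) (Fin c) ∘↔ ⊎-cong +↔⊎ ↔-refl ∘↔ +↔⊎

runitB : ∀ a → Bij (a + 0) a
runitB a = ⊎0 ∘↔ +↔⊎
  where
  ⊎0 : (Fin a ⊎ Fin 0) ↔ Fin a
  ⊎0 = mk↔ₛ′ to inj₁ (λ _ → refl) inv
    where
    to : Fin a ⊎ Fin 0 → Fin a
    to (inj₁ i) = i
    to (inj₂ ())
    inv : ∀ x → inj₁ (to x) ≡ x
    inv (inj₁ i) = refl
    inv (inj₂ ())

swapB : ∀ a b → Bij (a + b) (b + a)
swapB a b = ↔-sym +↔⊎ ∘↔ ⊎-comm (Fin a) (Fin b) ∘↔ +↔⊎

-- θ : 𝐦₁ + 𝟏 + 𝐦₂ → 𝐦₁ + 𝐦₂ + 𝟏 (fixes 1..m₁, m₁+1 ↦ m₁+m₂+1, m₁+1+i ↦ m₁+i)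
θB : ∀ m₁ m₂ → Bij ((m₁ + 1) + m₂) ((m₁ + m₂) + 1)
θB m₁ m₂ = ↔-sym (assocB m₁ m₂ 1) ∘B (idB {m₁} ⊕ swapB 1 m₂) ∘B assocB m₁ 1 m₂

swapLastB : ∀ n → Bij ((n + 1) + 1) ((n + 1) + 1)
swapLastB n = ↔-sym (assocB n 1 1) ∘B (idB {n} ⊕ swapB 1 1) ∘B assocB n 1 1

-- Species.  The given species X is Set-valued (an object of 𝓑 = Set^𝔹),
-- with strict functor laws.

record SetSpecies : Set₁ where
  field
    F      : ℕ → Set
    map    : ∀ {m n} → Bij m n → F m → F n
    map-id : ∀ {n} (x : F n) → map (idB {n}) x ≡ x
    map-∘  : ∀ {a b c} (g : Bij b c) (f : Bij a b) (x : F a) →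
             map (g ∘B f) x ≡ map g (map f x)
    map-cong : ∀ {m n} {f g : Bij m n} → f ≗B g → (x : F m) → map f x ≡ map g x

-- Constructed species (Day convolutions etc.) are presented by
-- representatives: a family of sets, the equality relation on them
-- (for Day convolution: the coend relation), and the action of 𝔹.
record Sp : Set₁ where
  field
    F    : ℕ → Set
    _≈_  : ∀ {n} → F n → F n → Set
    map  : ∀ {m n} → Bij m n → F m → F n

open Sp

⌜_⌝ : SetSpecies → Sp
⌜ X ⌝ = record { F = SetSpecies.F X ; _≈_ = _≡_ ; map = SetSpecies.map X }

infix 2 _⇒_
record _⇒_ (A B : Sp) : Set where
  constructor hom
  infixr 20 _·_
  field
    _·_ : ∀ {n} → F A n → F B n

open _⇒_ public

_≐_ : {A B : Sp} → (A ⇒ B) → (A ⇒ B) → Set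
_≐_ {A} {B} f g = ∀ {n} (x : F A n) → _≈_ B (f · x) (g · x)

infixr 9 _∘ₛ_
_∘ₛ_ : {A B C : Sp} → (B ⇒ C) → (A ⇒ B) → (A ⇒ C)
g ∘ₛ f = hom (λ x → g · (f · x))

idₛ : {A : Sp} → A ⇒ A
idₛ = hom (λ x → x)

record IsHom (A B : Sp) (f : A ⇒ B) : Set where
  field
    cong    : ∀ {n} {x y : F A n} → _≈_ A x y → _≈_ B (f · x) (f · y)
    natural : ∀ {m n} (g : Bij m n) (x : F A m) → _≈_ B (f · (map A g x)) (map B g (f · x))

record DayEl (A B : Sp) (n : ℕ) : Set where
  constructor [_,_,_]
  field
    {m₁ m₂} : ℕ
    fst : F A m₁
    snd : F B m₂
    bij : Bij (m₁ + m₂) n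

-- the coend relation: since 𝔹 is a groupoid, [x,y,f] = [x',y',f'] iff
-- there are g : 𝐦₁ → 𝐦₁', h : 𝐦₂ → 𝐦₂' with x' = A(g)x, y' = B(h)y and
-- f = f' ∘ (g ⊗ h).
_∼Day_ : ∀ {A B : Sp} {n} → DayEl A B n → DayEl A B n → Set
_∼Day_ {A} {B} [ x , y , f ] [ x' , y' , f' ] =
  Σ (Bij _ _) λ g → Σ (Bij _ _) λ h →
    _≈_ A (map A g x) x' × _≈_ B (map B h y) y' × (f ≗B (f' ∘B (g ⊕ h)))

infixr 6 _⊗̂_
_⊗̂_ : Sp → Sp → Sp
A ⊗̂ B = record
  { F = DayEl A B
  ; _≈_ = _∼Day_
  ; map = λ k → λ { [ x , y , f ] → [ x , y , k ∘B f ] } }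

infixr 6 _⊗₁_
_⊗₁_ : {A B C D : Sp} → (A ⇒ C) → (B ⇒ D) → (A ⊗̂ B ⇒ C ⊗̂ D)
f ⊗₁ g = hom λ { [ x , y , k ] → [ f · x , g · y , k ] }

J : Sp
J = record { F = Bij 0 ; _≈_ = _≗B_ ; map = _∘B_ }

α : {A B C : Sp} → (A ⊗̂ B) ⊗̂ C ⇒ A ⊗̂ (B ⊗̂ C)
α = hom λ { ([_,_,_] {_} {c} ([_,_,_] {a} {b} x y f) z g) →
  [ x , [ y , z , idB ] , g ∘B (f ⊕ idB) ∘B invB (assocB a b c) ] }

α⁻¹ : {A B C : Sp} → A ⊗̂ (B ⊗̂ C) ⇒ (A ⊗̂ B) ⊗̂ C
α⁻¹ = hom λ { ([_,_,_] {a} x ([_,_,_] {b} {c} y z f) g) →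
  [ [ x , y , idB ] , z , g ∘B (idB ⊕ f) ∘B assocB a b c ] }

λₛ : {A : Sp} → J ⊗̂ A ⇒ A
λₛ {A} = hom λ { [ j , x , f ] → map A (f ∘B (j ⊕ idB)) x }

rₛ : {A : Sp} → A ⊗̂ J ⇒ A
rₛ {A} = hom λ { [ x , j , f ] → map A (f ∘B (idB ⊕ j) ∘B invB (runitB _)) x }

γ : {A B : Sp} → A ⊗̂ B ⇒ B ⊗̂ A
γ = hom λ { ([_,_,_] {a} {b} x y f) → [ y , x , f ∘B swapB b a ] }

infixr 5 _⊕ₛ_
_⊕ₛ_ : Sp → Sp → Sp
A ⊕ₛ B = record
  { F = λ n → F A n ⊎ F B n
  ; _≈_ = λ { (inj₁ a) (inj₁ a') → _≈_ A a a'
            ; (inj₂ b) (inj₂ b') → _≈_ B b b'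
            ; _ _ → Data.Empty.⊥ }
  ; map = λ { g (inj₁ a) → inj₁ (map A g a) ; g (inj₂ b) → inj₂ (map B g b) } }
  where import Data.Empty

[_,_]ₛ : {A B C : Sp} → (A ⇒ C) → (B ⇒ C) → (A ⊕ₛ B ⇒ C)
[ f , g ]ₛ = hom λ { (inj₁ a) → f · a ; (inj₂ b) → g · b }

infixr 5 _+₁_
_+₁_ : {A B C D : Sp} → (A ⇒ C) → (B ⇒ D) → (A ⊕ₛ B ⇒ C ⊕ₛ D)
f +₁ g = hom λ { (inj₁ a) → inj₁ (f · a) ; (inj₂ b) → inj₂ (g · b) }

dist : {A B C : Sp} → (A ⊕ₛ B) ⊗̂ C ⇒ (A ⊗̂ C) ⊕ₛ (B ⊗̂ C)
dist = hom λ { [ inj₁ a , z , f ] → inj₁ [ a , z , f ]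
             ; [ inj₂ b , z , f ] → inj₂ [ b , z , f ] }

δ : Sp → Sp
δ A = record
  { F = λ n → F A (n + 1)
  ; _≈_ = _≈_ A
  ; map = λ f → map A (f ⊕ idB {1}) }

δ₁ : {A B : Sp} → (A ⇒ B) → (δ A ⇒ δ B)
δ₁ f = hom (λ x → f · x)

swapₛ : (A : Sp) → δ (δ A) ⇒ δ (δ A)
swapₛ A = hom (λ {n} → map A (swapLastB n))

str' : {A B : Sp} → A ⊗̂ δ B ⇒ δ (A ⊗̂ B)
str' = hom λ { ([_,_,_] {a} {b} x y f) → [ x , y , (f ⊕ idB {1}) ∘B invB (assocB a b 1) ] }

str : {A B : Sp} → δ A ⊗̂ B ⇒ δ (A ⊗̂ B)
str = hom λ { ([_,_,_] {a} {b} x y f) → [ x , y , (f ⊕ idB {1}) ∘B θB a b ] }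

record IsInverseOfStr (A B : Sp) (L : δ (A ⊗̂ B) ⇒ (δ A ⊗̂ B) ⊕ₛ (A ⊗̂ δ B)) : Set where
  field
    cong    : ∀ {n} {x y : F (δ (A ⊗̂ B)) n} → _≈_ (δ (A ⊗̂ B)) x y →
              _≈_ ((δ A ⊗̂ B) ⊕ₛ (A ⊗̂ δ B)) (L · x) (L · y)
    inverseˡ : _≐_ {δ (A ⊗̂ B)} {δ (A ⊗̂ B)} ([ str {A} {B} , str' {A} {B} ]ₛ ∘ₛ L) idₛ
    inverseʳ : _≐_ {(δ A ⊗̂ B) ⊕ₛ (A ⊗̂ δ B)} {(δ A ⊗̂ B) ⊕ₛ (A ⊗̂ δ B)}
                 (L ∘ₛ [ str {A} {B} , str' {A} {B} ]ₛ) idₛ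

module _ (X : SetSpecies) where
  private X' = ⌜ X ⌝

  CondA : (δ X' ⊗̂ X' ⇒ X') → (J ⇒ δ X') → Set
  CondA σ ν = _≐_ {J ⊗̂ X'} {X'} (σ ∘ₛ (ν ⊗₁ idₛ)) (λₛ {X'})

  CondB : (δ X' ⊗̂ X' ⇒ X') → (J ⇒ δ X') → Set
  CondB σ ν = _≐_ {δ X' ⊗̂ J} {δ X'}
    (δ₁ {δ X' ⊗̂ X'} {X'} σ ∘ₛ str' {δ X'} {X'} ∘ₛ (idₛ {δ X'} ⊗₁ ν)) (rₛ {δ X'})

  -- (c)  σ ∘ (id ⊗ σ) = σ ∘ (δσ ⊗ id) ∘ (str'_{δX,X} ⊗ id)
  --      (compared on (δX ⊗ δX) ⊗ X, the left side precomposed with α)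
  CondC : (δ X' ⊗̂ X' ⇒ X') → Set
  CondC σ = _≐_ {(δ X' ⊗̂ δ X') ⊗̂ X'} {X'}
    (σ ∘ₛ (idₛ {δ X'} ⊗₁ σ) ∘ₛ α {δ X'} {δ X'} {X'})
    (σ ∘ₛ (δ₁ {δ X' ⊗̂ X'} {X'} σ ⊗₁ idₛ {X'}) ∘ₛ (str' {δ X'} {X'} ⊗₁ idₛ {X'}))

  CondD : (δ X' ⊗̂ X' ⇒ X') → Set
  CondD σ = _≐_ {(δ (δ X') ⊗̂ X') ⊗̂ X'} {X'}
    (σ ∘ₛ (δ₁ {δ X' ⊗̂ X'} {X'} σ ⊗₁ idₛ {X'}) ∘ₛ (str {δ X'} {X'} ⊗₁ idₛ {X'}))
    (σ ∘ₛ (δ₁ {δ X' ⊗̂ X'} {X'} σ ⊗₁ idₛ {X'}) ∘ₛ (str {δ X'} {X'} ⊗₁ idₛ {X'})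
       ∘ₛ α⁻¹ {δ (δ X')} {X'} {X'}
       ∘ₛ (idₛ {δ (δ X')} ⊗₁ γ {X'} {X'})
       ∘ₛ (swapₛ X' ⊗₁ idₛ {X' ⊗̂ X'})
       ∘ₛ α {δ (δ X')} {X'} {X'})

  IsLinearSubstitutionAlgebra : (δ X' ⊗̂ X' ⇒ X') → (J ⇒ δ X') → Set
  IsLinearSubstitutionAlgebra σ ν = CondA σ ν × CondB σ ν × CondC σ × CondD σ

  Σ† : Sp → Sp → Sp
  Σ† A B = (δ B ⊗̂ A) ⊕ₛ (δ A ⊗̂ B)

  Σ†₁ : {A B A' B' : Sp} → (A ⇒ A') → (B ⇒ B') → (Σ† A B ⇒ Σ† A' B')
  Σ†₁ {A} {B} {A'} {B'} f g =
    (δ₁ {B} {B'} g ⊗₁ f) +₁ (δ₁ {A} {A'} f ⊗₁ g)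

  swapSub : (δ (δ X' ⊗̂ X') ⇒ (δ (δ X') ⊗̂ X') ⊕ₛ (δ X' ⊗̂ δ X')) →
            δ (δ X' ⊗̂ X') ⇒ Σ† X' (δ X')
  swapSub L = ((swapₛ X' ⊗₁ idₛ {X'}) +₁ idₛ {δ X' ⊗̂ δ X'}) ∘ₛ L

  strSub : (A B C : Sp) → Σ† A B ⊗̂ C ⇒ Σ† A (B ⊗̂ C)
  strSub A B C =
    (((str {B} {C} ⊗₁ idₛ {A}) ∘ₛ α⁻¹ {δ B} {C} {A} ∘ₛ (idₛ {δ B} ⊗₁ γ {A} {C})
       ∘ₛ α {δ B} {A} {C})
    +₁ α {δ A} {B} {C})
    ∘ₛ dist {δ B ⊗̂ A} {δ A ⊗̂ B} {C}

  ExtSubst : (δ X' ⊗̂ X' ⇒ X') →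
             (δ (δ X' ⊗̂ X') ⇒ (δ (δ X') ⊗̂ X') ⊕ₛ (δ X' ⊗̂ δ X')) → Set
  ExtSubst σ L = _≐_ {δ (δ X' ⊗̂ X') ⊗̂ X'} {X'}
    (σ ∘ₛ (δ₁ {δ X' ⊗̂ X'} {X'} σ ⊗₁ idₛ {X'}))
    ([ σ , σ ]ₛ
       ∘ₛ Σ†₁ {X'} {δ X' ⊗̂ X'} {X'} {X'} (idₛ {X'}) σ
       ∘ₛ strSub X' (δ X') X'
       ∘ₛ (swapSub L ⊗₁ idₛ {X'}))

{-# OPTIONS --safe #-}
-- [str , str'] : δA ⊗ B + A ⊗ δB → δ(A ⊗ B) is invertible with inverse L, so a map Θ out of
-- δ(A ⊗ B) ⊗ C equals the copairing [Ψ₁ , Ψ₂] ∘ (L ⊗ id) iff Θ ∘ (str ⊗ id) = Ψ₁ and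
-- Θ ∘ (str' ⊗ id) = Ψ₂, as long as Θ, Ψ₁ and Ψ₂ are well defined on Day convolution classes.
-- For Θ = σ ∘ (δσ ⊗ id) the right side of the extended substitution lemma is exactly such a
-- copairing, of the right side of (d) and the left side of (c); hence the extended lemma is
-- equivalent to (c) ∧ (d), while (a) and (b) are carried along. That the sides of (c) and (d)
-- are well defined follows from σ being a morphism together with the naturality of the
-- structural bijections of 𝔹: blockwise sum, associator, symmetry and θ.
module Submission where

open import Defs
open import Level using (0ℓ)
open import Data.Nat using (ℕ; _+_)
open import Data.Fin using (Fin; _↑ˡ_; _↑ʳ_; splitAt; join)
open import Data.Fin.Properties using (splitAt-↑ˡ; splitAt-↑ʳ; splitAt⁻¹-↑ˡ; splitAt⁻¹-↑ʳ; splitAt-join; join-splitAt)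
open import Data.Product using (_×_; _,_)
open import Data.Sum using (inj₁; inj₂; map)
import Data.Sum.Properties as Sum
open import Function.Base using (_∘_)
open import Function.Bundles using (Inverse; Equivalence; _⇔_; mk⇔)
open import Relation.Binary.Bundles using (Setoid)
open import Relation.Binary.PropositionalEquality using (_≡_; refl; sym; trans; cong; subst; module ≡-Reasoning)
import Relation.Binary.Reasoning.Setoid as SetoidReasoning

open Inverse using (to; from; strictlyInverseˡ; strictlyInverseʳ)
open Sp using (F; _≈_)

≗B-setoid : ℕ → ℕ → Setoid 0ℓ 0ℓ
≗B-setoid a b = record
  { Carrier = Bij a b
  ; _≈_ = _≗B_
  ; isEquivalence = record
    { refl = λ _ → refl
    ; sym = λ e i → sym (e i)
    ; trans = λ e e' i → trans (e i) (e' i) } }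

-- _≗B_ unfolds to a pointwise statement, from which Agda cannot recover the bijections involved;
-- steps of ≗B-chains are therefore mostly given pointwise.
module ≗B-Reasoning {a b : ℕ} = SetoidReasoning (≗B-setoid a b)

⊕-cong : ∀ {a b c d} {f f' : Bij a c} {g g' : Bij b d} → f ≗B f' → g ≗B g' → (f ⊕ g) ≗B (f' ⊕ g')
⊕-cong {a} {c = c} {d} e e' i = cong (join c d) (Sum.map-cong e e' (splitAt a i))

⊕-id : ∀ a b → (idB {a} ⊕ idB {b}) ≗B idB
⊕-id a b i = trans (cong (join a b) (Sum.map-id (splitAt a i))) (join-splitAt a b i)

⊕-∘ : ∀ {a b c d e f} (g : Bij c e) (h : Bij d f) (g' : Bij a c) (h' : Bij b d) →
      ((g ∘B g') ⊕ (h ∘B h')) ≗B ((g ⊕ h) ∘B (g' ⊕ h'))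
⊕-∘ {a} {c = c} {d} {e} {f} g h g' h' i =
  cong (join e f) (trans (sym (Sum.map-map {f = to g'} {to h'} {to g} {to h} (splitAt a i)))
                         (cong (map (to g) (to h)) (sym (splitAt-join c d (map (to g') (to h') (splitAt a i))))))

data BlockView (a b : ℕ) : Fin (a + b) → Set where
  left  : ∀ u → BlockView a b (u ↑ˡ b)
  right : ∀ v → BlockView a b (a ↑ʳ v)

blockView : ∀ a b i → BlockView a b i
blockView a b i with splitAt a i in eq
... | inj₁ u = subst (BlockView a b) (splitAt⁻¹-↑ˡ eq) (left u)
... | inj₂ v = subst (BlockView a b) (splitAt⁻¹-↑ʳ eq) (right v)

module _ {a b c d} (f : Bij a c) (g : Bij b d) where
  ⊕-↑ˡ : ∀ u → to (f ⊕ g) (u ↑ˡ b) ≡ to f u ↑ˡ d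
  ⊕-↑ˡ u rewrite splitAt-↑ˡ a u b = refl

  ⊕-↑ʳ : ∀ v → to (f ⊕ g) (a ↑ʳ v) ≡ c ↑ʳ to g v
  ⊕-↑ʳ v rewrite splitAt-↑ʳ a b v = refl

module _ (a b c : ℕ) where
  assocB-↑ˡ↑ˡ : ∀ u → to (assocB a b c) ((u ↑ˡ b) ↑ˡ c) ≡ u ↑ˡ (b + c)
  assocB-↑ˡ↑ˡ u rewrite splitAt-↑ˡ (a + b) (u ↑ˡ b) c | splitAt-↑ˡ a u b = refl

  assocB-↑ʳ↑ˡ : ∀ v → to (assocB a b c) ((a ↑ʳ v) ↑ˡ c) ≡ a ↑ʳ (v ↑ˡ c)
  assocB-↑ʳ↑ˡ v rewrite splitAt-↑ˡ (a + b) (a ↑ʳ v) c | splitAt-↑ʳ a b v = refl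

  assocB-↑ʳ : ∀ w → to (assocB a b c) ((a + b) ↑ʳ w) ≡ a ↑ʳ (b ↑ʳ w)
  assocB-↑ʳ w rewrite splitAt-↑ʳ (a + b) c w = refl

module _ (a b : ℕ) where
  swapB-↑ˡ : ∀ u → to (swapB a b) (u ↑ˡ b) ≡ b ↑ʳ u
  swapB-↑ˡ u rewrite splitAt-↑ˡ a u b = refl

  swapB-↑ʳ : ∀ v → to (swapB a b) (a ↑ʳ v) ≡ v ↑ˡ a
  swapB-↑ʳ v rewrite splitAt-↑ʳ a b v = refl

assocB-natural : ∀ {a b c a' b' c'} (p : Bij a a') (q : Bij b b') (r : Bij c c') →
                 (assocB a' b' c' ∘B ((p ⊕ q) ⊕ r)) ≗B ((p ⊕ (q ⊕ r)) ∘B assocB a b c)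
assocB-natural {a} {b} {c} {a'} {b'} {c'} p q r i with blockView (a + b) c i
... | right w = begin
  to (assocB a' b' c') (to ((p ⊕ q) ⊕ r) ((a + b) ↑ʳ w))  ≡⟨ cong (to (assocB a' b' c')) (⊕-↑ʳ (p ⊕ q) r w) ⟩
  to (assocB a' b' c') ((a' + b') ↑ʳ to r w)             ≡⟨ assocB-↑ʳ a' b' c' (to r w) ⟩
  a' ↑ʳ (b' ↑ʳ to r w)                                   ≡⟨ cong (a' ↑ʳ_) (⊕-↑ʳ q r w) ⟨
  a' ↑ʳ to (q ⊕ r) (b ↑ʳ w)                              ≡⟨ ⊕-↑ʳ p (q ⊕ r) (b ↑ʳ w) ⟨
  to (p ⊕ (q ⊕ r)) (a ↑ʳ (b ↑ʳ w))                       ≡⟨ cong (to (p ⊕ (q ⊕ r))) (assocB-↑ʳ a b c w) ⟨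
  to (p ⊕ (q ⊕ r)) (to (assocB a b c) ((a + b) ↑ʳ w))   ∎
  where open ≡-Reasoning
... | left j with blockView a b j
...   | left u = begin
  to (assocB a' b' c') (to ((p ⊕ q) ⊕ r) ((u ↑ˡ b) ↑ˡ c))  ≡⟨ cong (to (assocB a' b' c')) (⊕-↑ˡ (p ⊕ q) r (u ↑ˡ b)) ⟩
  to (assocB a' b' c') (to (p ⊕ q) (u ↑ˡ b) ↑ˡ c')        ≡⟨ cong (λ k → to (assocB a' b' c') (k ↑ˡ c')) (⊕-↑ˡ p q u) ⟩
  to (assocB a' b' c') ((to p u ↑ˡ b') ↑ˡ c')            ≡⟨ assocB-↑ˡ↑ˡ a' b' c' (to p u) ⟩
  to p u ↑ˡ (b' + c')                                    ≡⟨ ⊕-↑ˡ p (q ⊕ r) u ⟨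
  to (p ⊕ (q ⊕ r)) (u ↑ˡ (b + c))                        ≡⟨ cong (to (p ⊕ (q ⊕ r))) (assocB-↑ˡ↑ˡ a b c u) ⟨
  to (p ⊕ (q ⊕ r)) (to (assocB a b c) ((u ↑ˡ b) ↑ˡ c))  ∎
  where open ≡-Reasoning
...   | right v = begin
  to (assocB a' b' c') (to ((p ⊕ q) ⊕ r) ((a ↑ʳ v) ↑ˡ c))  ≡⟨ cong (to (assocB a' b' c')) (⊕-↑ˡ (p ⊕ q) r (a ↑ʳ v)) ⟩
  to (assocB a' b' c') (to (p ⊕ q) (a ↑ʳ v) ↑ˡ c')        ≡⟨ cong (λ k → to (assocB a' b' c') (k ↑ˡ c')) (⊕-↑ʳ p q v) ⟩
  to (assocB a' b' c') ((a' ↑ʳ to q v) ↑ˡ c')            ≡⟨ assocB-↑ʳ↑ˡ a' b' c' (to q v) ⟩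
  a' ↑ʳ (to q v ↑ˡ c')                                   ≡⟨ cong (a' ↑ʳ_) (⊕-↑ˡ q r v) ⟨
  a' ↑ʳ to (q ⊕ r) (v ↑ˡ c)                              ≡⟨ ⊕-↑ʳ p (q ⊕ r) (v ↑ˡ c) ⟨
  to (p ⊕ (q ⊕ r)) (a ↑ʳ (v ↑ˡ c))                       ≡⟨ cong (to (p ⊕ (q ⊕ r))) (assocB-↑ʳ↑ˡ a b c v) ⟨
  to (p ⊕ (q ⊕ r)) (to (assocB a b c) ((a ↑ʳ v) ↑ˡ c))  ∎
  where open ≡-Reasoning

swapB-natural : ∀ {a b a' b'} (p : Bij a a') (q : Bij b b') →
                (swapB a' b' ∘B (p ⊕ q)) ≗B ((q ⊕ p) ∘B swapB a b)
swapB-natural {a} {b} {a'} {b'} p q i with blockView a b i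
... | left u = begin
  to (swapB a' b') (to (p ⊕ q) (u ↑ˡ b))  ≡⟨ cong (to (swapB a' b')) (⊕-↑ˡ p q u) ⟩
  to (swapB a' b') (to p u ↑ˡ b')         ≡⟨ swapB-↑ˡ a' b' (to p u) ⟩
  b' ↑ʳ to p u                            ≡⟨ ⊕-↑ʳ q p u ⟨
  to (q ⊕ p) (b ↑ʳ u)                     ≡⟨ cong (to (q ⊕ p)) (swapB-↑ˡ a b u) ⟨
  to (q ⊕ p) (to (swapB a b) (u ↑ˡ b))    ∎
  where open ≡-Reasoning
... | right v = begin
  to (swapB a' b') (to (p ⊕ q) (a ↑ʳ v))  ≡⟨ cong (to (swapB a' b')) (⊕-↑ʳ p q v) ⟩
  to (swapB a' b') (a' ↑ʳ to q v)         ≡⟨ swapB-↑ʳ a' b' (to q v) ⟩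
  to q v ↑ˡ a'                            ≡⟨ ⊕-↑ˡ q p v ⟨
  to (q ⊕ p) (v ↑ˡ a)                     ≡⟨ cong (to (q ⊕ p)) (swapB-↑ʳ a b v) ⟨
  to (q ⊕ p) (to (swapB a b) (a ↑ʳ v))    ∎
  where open ≡-Reasoning

invB-natural : ∀ {a b a' b'} (h : Bij a b) (h' : Bij a' b') (P : Bij a a') (Q : Bij b b') →
               (h' ∘B P) ≗B (Q ∘B h) → (invB h' ∘B Q) ≗B (P ∘B invB h)
invB-natural h h' P Q e i = begin
  from h' (to Q i)                       ≡⟨ cong (from h' ∘ to Q) (strictlyInverseˡ h i) ⟨
  from h' (to Q (to h (from h i)))       ≡⟨ cong (from h') (e (from h i)) ⟨
  from h' (to h' (to P (from h i)))      ≡⟨ strictlyInverseʳ h' (to P (from h i)) ⟩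
  to P (from h i)                        ∎
  where open ≡-Reasoning

⊕-interchange : ∀ {a a' b b' c c'} (p : Bij a a') {q : Bij b b'} {q' : Bij c c'} {g : Bij b c} {g' : Bij b' c'} →
                (g' ∘B q) ≗B (q' ∘B g) → ((idB ⊕ g') ∘B (p ⊕ q)) ≗B ((p ⊕ q') ∘B (idB ⊕ g))
⊕-interchange p {q} {q'} {g} {g'} e = begin
  (idB ⊕ g') ∘B (p ⊕ q)  ≈⟨ ⊕-∘ idB g' p q ⟨
  p ⊕ (g' ∘B q)          ≈⟨ ⊕-cong {f = p} {p} {g' ∘B q} {q' ∘B g} (λ _ → refl) e ⟩
  p ⊕ (q' ∘B g)          ≈⟨ ⊕-∘ p q' idB g ⟩
  (p ⊕ q') ∘B (idB ⊕ g)  ∎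
  where open ≗B-Reasoning

θB-natural : ∀ {a b a' b'} (p : Bij a a') (q : Bij b b') →
             (θB a' b' ∘B ((p ⊕ idB {1}) ⊕ q)) ≗B (((p ⊕ q) ⊕ idB {1}) ∘B θB a b)
θB-natural {a} {b} {a'} {b'} p q = begin
  invB (assocB a' b' 1) ∘B (idB {a'} ⊕ swapB 1 b') ∘B assocB a' 1 b' ∘B ((p ⊕ idB) ⊕ q)
    ≈⟨ (λ i → cong (from (assocB a' b' 1) ∘ to (idB {a'} ⊕ swapB 1 b')) (assocB-natural p idB q i)) ⟩
  invB (assocB a' b' 1) ∘B (idB {a'} ⊕ swapB 1 b') ∘B (p ⊕ (idB ⊕ q)) ∘B assocB a 1 b
    ≈⟨ (λ i → cong (from (assocB a' b' 1))
                   (⊕-interchange p {idB ⊕ q} {q ⊕ idB} {swapB 1 b} {swapB 1 b'} (swapB-natural idB q)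
                                  (to (assocB a 1 b) i))) ⟩
  invB (assocB a' b' 1) ∘B (p ⊕ (q ⊕ idB)) ∘B (idB {a} ⊕ swapB 1 b) ∘B assocB a 1 b
    ≈⟨ (λ i → invB-natural (assocB a b 1) (assocB a' b' 1) ((p ⊕ q) ⊕ idB) (p ⊕ (q ⊕ idB))
                           (assocB-natural p q idB) (to ((idB {a} ⊕ swapB 1 b) ∘B assocB a 1 b) i)) ⟩
  ((p ⊕ q) ⊕ idB) ∘B invB (assocB a b 1) ∘B (idB {a} ⊕ swapB 1 b) ∘B assocB a 1 b
    ∎
  where open ≗B-Reasoning

swapLastB-natural : ∀ {a a'} (p : Bij a a') →
                    (swapLastB a' ∘B ((p ⊕ idB {1}) ⊕ idB {1})) ≗B (((p ⊕ idB {1}) ⊕ idB {1}) ∘B swapLastB a)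
swapLastB-natural p = θB-natural p idB

-- The bijections that α and α⁻¹ ∘ (id ⊗ γ) ∘ α attach to [ [ x , y , g ] , z , f ], and that
-- str attaches to [ x , z , idB ].
αB : ∀ {a b m₁ m₂ n} → Bij (m₁ + m₂) n → Bij (a + b) m₁ → Bij (a + (b + m₂)) n
αB {a} {b} {m₂ = m₂} f g = f ∘B (g ⊕ idB) ∘B invB (assocB a b m₂)

βB : ∀ {a b m₁ m₂ n} → Bij (m₁ + m₂) n → Bij (a + b) m₁ → Bij ((a + m₂) + b) n
βB {a} {b} {m₂ = m₂} f g = αB {a} {b} f g ∘B (idB {a} ⊕ (idB ∘B swapB m₂ b)) ∘B assocB a m₂ b

strB : ∀ a m → Bij ((a + 1) + m) ((a + m) + 1)
strB a m = (idB {a + m} ⊕ idB {1}) ∘B θB a m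

strB-natural : ∀ {a a' m} (p : Bij a a') →
               (strB a' m ∘B ((p ⊕ idB {1}) ⊕ idB {m})) ≗B (((p ⊕ idB {m}) ⊕ idB {1}) ∘B strB a m)
strB-natural {a} {a'} {m} p i = begin
  to (strB a' m) (to ((p ⊕ idB) ⊕ idB) i)          ≡⟨ ⊕-id (a' + m) 1 _ ⟩
  to (θB a' m) (to ((p ⊕ idB) ⊕ idB) i)            ≡⟨ θB-natural p idB i ⟩
  to ((p ⊕ idB) ⊕ idB) (to (θB a m) i)             ≡⟨ cong (to ((p ⊕ idB) ⊕ idB)) (⊕-id (a + m) 1 _) ⟨
  to ((p ⊕ idB) ⊕ idB) (to (strB a m) i)           ∎
  where open ≡-Reasoning

module _ {a a' b b' m₁ m₂ n} (f : Bij (m₁ + m₂) n) {g : Bij (a + b) m₁} {g' : Bij (a' + b') m₁}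
         (p : Bij a a') (q : Bij b b') (g≗g'∘p⊕q : g ≗B (g' ∘B (p ⊕ q))) where
  private
    α₀ : Bij (a + (b + m₂)) n
    α₀ = αB {a} {b} {m₂ = m₂} f g
    α₁ : Bij (a' + (b' + m₂)) n
    α₁ = αB {a'} {b'} {m₂ = m₂} f g'

  αB-natural : (α₁ ∘B (p ⊕ (q ⊕ idB {m₂}))) ≗B α₀
  αB-natural = begin
    f ∘B (g' ⊕ idB) ∘B invB (assocB a' b' m₂) ∘B (p ⊕ (q ⊕ idB))
      ≈⟨ (λ i → cong (to (f ∘B (g' ⊕ idB {m₂})))
                     (invB-natural (assocB a b m₂) (assocB a' b' m₂) ((p ⊕ q) ⊕ idB) (p ⊕ (q ⊕ idB))
                                   (assocB-natural p q idB) i)) ⟩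
    f ∘B (g' ⊕ idB) ∘B ((p ⊕ q) ⊕ idB) ∘B invB (assocB a b m₂)
      ≈⟨ (λ i → cong (to f) (⊕-∘ g' idB (p ⊕ q) (idB {m₂}) (from (assocB a b m₂) i))) ⟨
    f ∘B ((g' ∘B (p ⊕ q)) ⊕ idB) ∘B invB (assocB a b m₂)
      ≈⟨ (λ i → cong (to f) (⊕-cong {f = g' ∘B (p ⊕ q)} {g} {idB {m₂}} {idB} (λ j → sym (g≗g'∘p⊕q j)) (λ _ → refl)
                                    (from (assocB a b m₂) i))) ⟩
    f ∘B (g ⊕ idB) ∘B invB (assocB a b m₂)
      ∎
    where open ≗B-Reasoning

  βB-natural : (βB {a'} {b'} f g' ∘B ((p ⊕ idB {m₂}) ⊕ q)) ≗B βB {a} {b} f g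
  βB-natural = begin
    α₁ ∘B (idB {a'} ⊕ (idB ∘B swapB m₂ b')) ∘B assocB a' m₂ b' ∘B ((p ⊕ idB) ⊕ q)
      ≈⟨ (λ i → cong (to (α₁ ∘B (idB {a'} ⊕ (idB ∘B swapB m₂ b')))) (assocB-natural p idB q i)) ⟩
    α₁ ∘B (idB {a'} ⊕ (idB ∘B swapB m₂ b')) ∘B (p ⊕ (idB ⊕ q)) ∘B assocB a m₂ b
      ≈⟨ (λ i → cong (to α₁)
                     (⊕-interchange p {idB ⊕ q} {q ⊕ idB} {idB ∘B swapB m₂ b} {idB ∘B swapB m₂ b'} (swapB-natural idB q)
                                    (to (assocB a m₂ b) i))) ⟩
    α₁ ∘B (p ⊕ (q ⊕ idB)) ∘B (idB {a} ⊕ (idB ∘B swapB m₂ b)) ∘B assocB a m₂ b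
      ≈⟨ (λ i → αB-natural (to ((idB {a} ⊕ (idB ∘B swapB m₂ b)) ∘B assocB a m₂ b) i)) ⟩
    α₀ ∘B (idB {a} ⊕ (idB ∘B swapB m₂ b)) ∘B assocB a m₂ b
      ∎
    where open ≗B-Reasoning

module DayMaps (C : Sp) (Y : SetSpecies) where

  DayMap : Sp → Set
  DayMap P = ∀ {m₁ m₂ n} → F P m₁ → F C m₂ → Bij (m₁ + m₂) n → SetSpecies.F Y n

  Respectsˡ : (P : Sp) → DayMap P → Set
  Respectsˡ P h = ∀ {m₁ m₂ n} (u u' : F P m₁) (z : F C m₂) (f : Bij (m₁ + m₂) n) →
                  _≈_ P u u' → h u z f ≡ h u' z f

  [_,_]ᵈ : {P Q : Sp} → DayMap P → DayMap Q → DayMap (P ⊕ₛ Q)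
  [ h₁ , h₂ ]ᵈ (inj₁ u) = h₁ u
  [ h₁ , h₂ ]ᵈ (inj₂ u) = h₂ u

  module _ (A B : Sp) (Θ : DayMap (δ (A ⊗̂ B))) where

    AlongStr : DayMap (δ A ⊗̂ B) → Set
    AlongStr Ψ = ∀ {m₁ m₂ n} (r : F (δ A ⊗̂ B) m₁) (z : F C m₂) (f : Bij (m₁ + m₂) n) →
                 Θ (str {A} {B} · r) z f ≡ Ψ r z f

    AlongStr' : DayMap (A ⊗̂ δ B) → Set
    AlongStr' Ψ = ∀ {m₁ m₂ n} (r : F (A ⊗̂ δ B) m₁) (z : F C m₂) (f : Bij (m₁ + m₂) n) →
                  Θ (str' {A} {B} · r) z f ≡ Ψ r z f

    FactorsThrough : (δ (A ⊗̂ B) ⇒ (δ A ⊗̂ B) ⊕ₛ (A ⊗̂ δ B)) → DayMap (δ A ⊗̂ B) → DayMap (A ⊗̂ δ B) → Set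
    FactorsThrough L Ψ₁ Ψ₂ = ∀ {m₁ m₂ n} (w : F (δ (A ⊗̂ B)) m₁) (z : F C m₂) (f : Bij (m₁ + m₂) n) →
                             Θ w z f ≡ [_,_]ᵈ {δ A ⊗̂ B} {A ⊗̂ δ B} Ψ₁ Ψ₂ (L · w) z f

  module AlongL {A B : Sp} {L : δ (A ⊗̂ B) ⇒ (δ A ⊗̂ B) ⊕ₛ (A ⊗̂ δ B)} (L-inv : IsInverseOfStr A B L)
                (Θ : DayMap (δ (A ⊗̂ B))) (Ψ₁ : DayMap (δ A ⊗̂ B)) (Ψ₂ : DayMap (A ⊗̂ δ B)) where

    private
      Ψ : DayMap ((δ A ⊗̂ B) ⊕ₛ (A ⊗̂ δ B))
      Ψ = [_,_]ᵈ {δ A ⊗̂ B} {A ⊗̂ δ B} Ψ₁ Ψ₂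

    split-along-L : Respectsˡ (δ (A ⊗̂ B)) Θ → AlongStr A B Θ Ψ₁ → AlongStr' A B Θ Ψ₂ →
                    FactorsThrough A B Θ L Ψ₁ Ψ₂
    split-along-L Θ-resp along-str along-str' w z f = by-cases (L · w) (IsInverseOfStr.inverseˡ L-inv w)
      where
      by-cases : ∀ s → _≈_ (δ (A ⊗̂ B)) ([ str {A} {B} , str' {A} {B} ]ₛ · s) w → Θ w z f ≡ Ψ s z f
      by-cases (inj₁ r) str·r≈w  = trans (sym (Θ-resp _ _ z f str·r≈w)) (along-str r z f)
      by-cases (inj₂ r) str'·r≈w = trans (sym (Θ-resp _ _ z f str'·r≈w)) (along-str' r z f)

    restrict-along-str : Respectsˡ (δ A ⊗̂ B) Ψ₁ → FactorsThrough A B Θ L Ψ₁ Ψ₂ → AlongStr A B Θ Ψ₁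
    restrict-along-str Ψ₁-resp factors r z f =
      by-cases (L · (str {A} {B} · r)) (IsInverseOfStr.inverseʳ L-inv (inj₁ r)) (factors (str {A} {B} · r) z f)
      where
      by-cases : ∀ s → _≈_ ((δ A ⊗̂ B) ⊕ₛ (A ⊗̂ δ B)) s (inj₁ r) →
                 Θ (str {A} {B} · r) z f ≡ Ψ s z f → Θ (str {A} {B} · r) z f ≡ Ψ₁ r z f
      by-cases (inj₁ r') r'≈r eq = trans eq (Ψ₁-resp r' r z f r'≈r)
      by-cases (inj₂ _)  ()   _

    restrict-along-str' : Respectsˡ (A ⊗̂ δ B) Ψ₂ → FactorsThrough A B Θ L Ψ₁ Ψ₂ → AlongStr' A B Θ Ψ₂
    restrict-along-str' Ψ₂-resp factors r z f =
      by-cases (L · (str' {A} {B} · r)) (IsInverseOfStr.inverseʳ L-inv (inj₂ r)) (factors (str' {A} {B} · r) z f)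
      where
      by-cases : ∀ s → _≈_ ((δ A ⊗̂ B) ⊕ₛ (A ⊗̂ δ B)) s (inj₂ r) →
                 Θ (str' {A} {B} · r) z f ≡ Ψ s z f → Θ (str' {A} {B} · r) z f ≡ Ψ₂ r z f
      by-cases (inj₂ r') r'≈r eq = trans eq (Ψ₂-resp r' r z f r'≈r)
      by-cases (inj₁ _)  ()   _

module Substitution (X : SetSpecies) (σ : δ ⌜ X ⌝ ⊗̂ ⌜ X ⌝ ⇒ ⌜ X ⌝)
                    (σ-hom : IsHom (δ ⌜ X ⌝ ⊗̂ ⌜ X ⌝) ⌜ X ⌝ σ) where
  open SetSpecies X using (map-id; map-∘; map-cong) renaming (F to Fˣ; map to mapX)
  open DayMaps ⌜ X ⌝ X

  mapδ : ∀ {a a'} → Bij a a' → Fˣ (a + 1) → Fˣ (a' + 1)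
  mapδ p = mapX (p ⊕ idB {1})

  -- σ ∘ (δσ ⊗ id), the left side of (c) and the right side of (d), on representatives.
  σ-δσ : DayMap (δ (δ ⌜ X ⌝ ⊗̂ ⌜ X ⌝))
  σ-δσ w z f = σ · [ σ · w , z , f ]

  σ-σ : DayMap (δ ⌜ X ⌝ ⊗̂ δ ⌜ X ⌝)
  σ-σ ([_,_,_] {a} {b} x y g) z f = σ · [ x , σ · [ y , z , idB ] , αB {a} {b} f g ]

  σ-δσ-swap : DayMap (δ (δ ⌜ X ⌝) ⊗̂ ⌜ X ⌝)
  σ-δσ-swap {m₂ = m₂} ([_,_,_] {a} {b} x y g) z f =
    σ · [ σ · [ mapX (swapLastB a) x , z , strB a m₂ ] , y , βB {a} {b} f g ]

  σ-cong : ∀ {a b n} {x : Fˣ (a + 1)} {y : Fˣ b} {k k' : Bij (a + b) n} →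
           k ≗B k' → σ · [ x , y , k ] ≡ σ · [ x , y , k' ]
  σ-cong {a} {b} {x = x} {y} {k' = k'} k≗k' = IsHom.cong σ-hom
    ( idB , idB , trans (map-cong (⊕-id a 1) x) (map-id x) , map-id y
    , λ i → trans (k≗k' i) (cong (to k') (sym (⊕-id a b i))) )

  -- Used with T≗T' and K≗K' both λ _ → refl to pass between definitionally equal forms: comparing
  -- bijections pointwise is far cheaper for Agda than comparing them as Inverse records.
  σσ-cong : ∀ {a b c m n} {x : Fˣ (a + 1)} {y : Fˣ b} {z : Fˣ m}
            {T T' : Bij (a + b) (c + 1)} {K K' : Bij (c + m) n} →
            T ≗B T' → K ≗B K' → σ · [ σ · [ x , y , T ] , z , K ] ≡ σ · [ σ · [ x , y , T' ] , z , K' ]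
  σσ-cong {y = y} {z} {K = K} T≗T' K≗K' =
    trans (cong (λ s → σ · [ s , z , K ]) (σ-cong {y = y} T≗T')) (σ-cong K≗K')

  σ-map : ∀ {a a' b b' n} (p : Bij a a') (q : Bij b b') {k : Bij (a' + b') n} {k' : Bij (a + b) n} x y →
          (k ∘B (p ⊕ q)) ≗B k' → σ · [ mapδ p x , mapX q y , k ] ≡ σ · [ x , y , k' ]
  σ-map p q x y e = sym (IsHom.cong σ-hom (p , q , refl , refl , λ i → sym (e i)))

  σ-mapˡ : ∀ {a a' m n n'} (p : Bij a a') (P : Bij n n') {T' : Bij (a' + m) n'} {T : Bij (a + m) n} x z →
           (T' ∘B (p ⊕ idB)) ≗B (P ∘B T) → σ · [ mapδ p x , z , T' ] ≡ mapX P (σ · [ x , z , T ])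
  σ-mapˡ p P {T = T} x z e =
    trans (sym (IsHom.cong σ-hom (p , idB , refl , map-id z , λ i → sym (e i))))
          (IsHom.natural σ-hom P [ x , z , T ])

  σ-δσ-respectsˡ : Respectsˡ (δ (δ ⌜ X ⌝ ⊗̂ ⌜ X ⌝)) σ-δσ
  σ-δσ-respectsˡ _ _ z f w≈w' = cong (λ s → σ · [ s , z , f ]) (IsHom.cong σ-hom w≈w')

  σ-σ-respectsˡ : Respectsˡ (δ ⌜ X ⌝ ⊗̂ δ ⌜ X ⌝) σ-σ
  σ-σ-respectsˡ {m₂ = m₂} ([_,_,_] {a} {b} x y g) ([_,_,_] {a'} {b'} _ _ g') z f
                (p , q , refl , refl , g≗g'∘p⊕q) = sym (begin
    σ · [ mapδ p x , σ · [ mapδ q y , z , idB ] , αB {a'} {b'} f g' ]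
      ≡⟨ cong (λ s → σ · [ mapδ p x , s , αB {a'} {b'} f g' ]) (σ-mapˡ q (q ⊕ idB {m₂}) {T = idB} y z (λ _ → refl)) ⟩
    σ · [ mapδ p x , mapX (q ⊕ idB) (σ · [ y , z , idB ]) , αB {a'} {b'} f g' ]
      ≡⟨ σ-map p (q ⊕ idB {m₂}) x (σ · [ y , z , idB ]) (αB-natural {m₂ = m₂} f {g} {g'} p q g≗g'∘p⊕q) ⟩
    σ · [ x , σ · [ y , z , idB ] , αB {a} {b} f g ]
      ∎)
    where open ≡-Reasoning

  swapₛ-natural : ∀ {a a'} (p : Bij a a') (x : Fˣ ((a + 1) + 1)) →
                  mapX (swapLastB a') (mapδ (p ⊕ idB) x) ≡ mapδ (p ⊕ idB) (mapX (swapLastB a) x)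
  swapₛ-natural {a} {a'} p x = begin
    mapX (swapLastB a') (mapδ (p ⊕ idB) x)      ≡⟨ map-∘ (swapLastB a') ((p ⊕ idB) ⊕ idB) x ⟨
    mapX (swapLastB a' ∘B ((p ⊕ idB) ⊕ idB)) x  ≡⟨ map-cong (swapLastB-natural p) x ⟩
    mapX (((p ⊕ idB) ⊕ idB) ∘B swapLastB a) x   ≡⟨ map-∘ ((p ⊕ idB) ⊕ idB) (swapLastB a) x ⟩
    mapδ (p ⊕ idB) (mapX (swapLastB a) x)       ∎
    where open ≡-Reasoning

  σ-δσ-swap-respectsˡ : Respectsˡ (δ (δ ⌜ X ⌝) ⊗̂ ⌜ X ⌝) σ-δσ-swap
  σ-δσ-swap-respectsˡ {m₂ = m₂} ([_,_,_] {a} {b} x y g) ([_,_,_] {a'} {b'} _ _ g') z f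
                      (p , q , refl , refl , g≗g'∘p⊕q) = sym (begin
    σ · [ σ · [ mapX (swapLastB a') (mapδ (p ⊕ idB) x) , z , strB a' m₂ ] , mapX q y , βB {a'} {b'} f g' ]
      ≡⟨ cong (λ s → σ · [ σ · [ s , z , strB a' m₂ ] , mapX q y , βB {a'} {b'} f g' ]) (swapₛ-natural p x) ⟩
    σ · [ σ · [ mapδ (p ⊕ idB) sx , z , strB a' m₂ ] , mapX q y , βB {a'} {b'} f g' ]
      ≡⟨ cong (λ t → σ · [ t , mapX q y , βB {a'} {b'} f g' ])
              (σ-mapˡ (p ⊕ idB) ((p ⊕ idB {m₂}) ⊕ idB) {T = strB a m₂} sx z (strB-natural p)) ⟩
    σ · [ mapδ (p ⊕ idB {m₂}) (σ · [ sx , z , strB a m₂ ]) , mapX q y , βB {a'} {b'} f g' ]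
      ≡⟨ σ-map (p ⊕ idB {m₂}) q (σ · [ sx , z , strB a m₂ ]) y
               (βB-natural {m₂ = m₂} f {g} {g'} p q g≗g'∘p⊕q) ⟩
    σ · [ σ · [ sx , z , strB a m₂ ] , y , βB {a} {b} f g ]
      ∎)
    where
    open ≡-Reasoning
    sx = mapX (swapLastB a) x

  CondD⇔ : CondD X σ ⇔ AlongStr (δ ⌜ X ⌝) ⌜ X ⌝ σ-δσ σ-δσ-swap
  CondD⇔ = mk⇔ forward backward
    where
    forward : CondD X σ → AlongStr (δ ⌜ X ⌝) ⌜ X ⌝ σ-δσ σ-δσ-swap
    forward cd {m₁} {m₂} ([_,_,_] {a} {b} x y g) z f =
      trans (σσ-cong {a + 1} {b} {m₁} {m₂} (λ _ → refl) (λ _ → refl))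
     (trans (cd [ [ x , y , g ] , z , f ])
            (σσ-cong {a + 1} {m₂} {a + m₂} {b} (λ _ → refl) (λ _ → refl)))
    backward : AlongStr (δ ⌜ X ⌝) ⌜ X ⌝ σ-δσ σ-δσ-swap → CondD X σ
    backward along ([_,_,_] {m₁} {m₂} ([_,_,_] {a} {b} x y g) z f) =
      trans (σσ-cong {a + 1} {b} {m₁} {m₂} (λ _ → refl) (λ _ → refl))
     (trans (along [ x , y , g ] z f)
            (σσ-cong {a + 1} {m₂} {a + m₂} {b} (λ _ → refl) (λ _ → refl)))

  CondC⇔ : CondC X σ ⇔ AlongStr' (δ ⌜ X ⌝) ⌜ X ⌝ σ-δσ σ-σ
  CondC⇔ = mk⇔ forward backward
    where
    forward : CondC X σ → AlongStr' (δ ⌜ X ⌝) ⌜ X ⌝ σ-δσ σ-σ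
    forward cc {m₁} {m₂} ([_,_,_] {a} {b} x y g) z f =
      sym (trans (cc [ [ x , y , g ] , z , f ]) (σσ-cong {a} {b + 1} {m₁} {m₂} (λ _ → refl) (λ _ → refl)))
    backward : AlongStr' (δ ⌜ X ⌝) ⌜ X ⌝ σ-δσ σ-σ → CondC X σ
    backward along ([_,_,_] {m₁} {m₂} ([_,_,_] {a} {b} x y g) z f) =
      sym (trans (σσ-cong {a} {b + 1} {m₁} {m₂} (λ _ → refl) (λ _ → refl)) (along [ x , y , g ] z f))

  -- The right side of the extended substitution lemma at [ w , z , f ], as a function of s = L · w.
  extSubst-rhs : DayMap ((δ (δ ⌜ X ⌝) ⊗̂ ⌜ X ⌝) ⊕ₛ (δ ⌜ X ⌝ ⊗̂ δ ⌜ X ⌝))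
  extSubst-rhs s z f =
    ([ σ , σ ]ₛ ∘ₛ Σ†₁ X {⌜ X ⌝} {δ ⌜ X ⌝ ⊗̂ ⌜ X ⌝} {⌜ X ⌝} {⌜ X ⌝} (idₛ {⌜ X ⌝}) σ ∘ₛ strSub X ⌜ X ⌝ (δ ⌜ X ⌝) ⌜ X ⌝)
      · [ ((swapₛ ⌜ X ⌝ ⊗₁ idₛ {⌜ X ⌝}) +₁ idₛ {δ ⌜ X ⌝ ⊗̂ δ ⌜ X ⌝}) · s , z , f ]

  extSubst-rhs-by-cases : ∀ {m₁ m₂ n} s (z : Fˣ m₂) (f : Bij (m₁ + m₂) n) →
                          extSubst-rhs s z f ≡ [_,_]ᵈ {δ (δ ⌜ X ⌝) ⊗̂ ⌜ X ⌝} {δ ⌜ X ⌝ ⊗̂ δ ⌜ X ⌝} σ-δσ-swap σ-σ s z f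
  extSubst-rhs-by-cases {m₂ = m₂} (inj₁ ([_,_,_] {a} {b} _ _ _)) _ _ =
    σσ-cong {a + 1} {m₂} {a + m₂} {b} (λ _ → refl) (λ _ → refl)
  extSubst-rhs-by-cases (inj₂ [ _ , _ , _ ]) _ _ = refl

  module _ (L : δ (δ ⌜ X ⌝ ⊗̂ ⌜ X ⌝) ⇒ (δ (δ ⌜ X ⌝) ⊗̂ ⌜ X ⌝) ⊕ₛ (δ ⌜ X ⌝ ⊗̂ δ ⌜ X ⌝)) where

    ExtSubst⇔ : ExtSubst X σ L ⇔ FactorsThrough (δ ⌜ X ⌝) ⌜ X ⌝ σ-δσ L σ-δσ-swap σ-σ
    ExtSubst⇔ = mk⇔ forward backward
      where
      forward : ExtSubst X σ L → FactorsThrough (δ ⌜ X ⌝) ⌜ X ⌝ σ-δσ L σ-δσ-swap σ-σ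
      forward ext [ x , y , g ] z f =
        trans (ext [ [ x , y , g ] , z , f ]) (extSubst-rhs-by-cases (L · [ x , y , g ]) z f)
      backward : FactorsThrough (δ ⌜ X ⌝) ⌜ X ⌝ σ-δσ L σ-δσ-swap σ-σ → ExtSubst X σ L
      backward factors [ w , z , f ] with L · w | factors w z f
      ... | inj₁ [ _ , _ , _ ] | eq = eq
      ... | inj₂ [ _ , _ , _ ] | eq = eq

mainTheorem4 : (X : SetSpecies)
    (σ : δ ⌜ X ⌝ ⊗̂ ⌜ X ⌝ ⇒ ⌜ X ⌝) (ν : J ⇒ δ ⌜ X ⌝) →
    IsHom (δ ⌜ X ⌝ ⊗̂ ⌜ X ⌝) ⌜ X ⌝ σ → IsHom J (δ ⌜ X ⌝) ν →
    (L : δ (δ ⌜ X ⌝ ⊗̂ ⌜ X ⌝) ⇒ (δ (δ ⌜ X ⌝) ⊗̂ ⌜ X ⌝) ⊕ₛ (δ ⌜ X ⌝ ⊗̂ δ ⌜ X ⌝)) →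
    IsInverseOfStr (δ ⌜ X ⌝) ⌜ X ⌝ L →
    (IsLinearSubstitutionAlgebra X σ ν ⇔ (CondA X σ ν × CondB X σ ν × ExtSubst X σ L))
-- ν need not be a morphism: (a) and (b) occur unchanged on both sides.
mainTheorem4 X σ ν σ-hom _ L L-inv = mk⇔
  (λ (condA , condB , condC , condD) →
     condA , condB ,
     from (ExtSubst⇔ L) (split-along-L σ-δσ-respectsˡ (to CondD⇔ condD) (to CondC⇔ condC)))
  (λ (condA , condB , extSubst) →
     condA , condB ,
     from CondC⇔ (restrict-along-str' σ-σ-respectsˡ (to (ExtSubst⇔ L) extSubst)) ,
     from CondD⇔ (restrict-along-str σ-δσ-swap-respectsˡ (to (ExtSubst⇔ L) extSubst)))
  where
  open Substitution X σ σ-hom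
  open DayMaps.AlongL ⌜ X ⌝ X L-inv σ-δσ σ-δσ-swap σ-σ
  open Equivalence using (to; from)
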